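{- Let $q$ be a prime power, let $n\ge 2k\ge 4$, and let $f$ be a trivial Boolean degree $1$ function on $J_q(n,k)$. Fix a hyperplane $\pi$, a point $a\in\pi$, and a line $\ell\not\subseteq\pi$ through $a$. Suppose that for every $k$-space $K$ containing $a$ we have $f(K)=1$ if $K\subseteq\pi$, $f(K)=1$ if $\ell\subseteq K$, and $f(K)=0$ otherwise. Then $f=p^+\vee\pi^+$ for some point $p\in\ell\setminus\{a\}$.
   Context: $J_q(n,k)$ is the set of all $k$-dimensional subspaces of $\mathbb{F}_q^n$. Points, lines and hyperplanes are subspaces of dimension $1$, $2$, $n-1$. For a point $p$, $p^+(S)=1$ if $p\subseteq S$, else $0$; for a hyperplane $\pi$, $\pi^+(S)=1$ if $S\subseteq\pi$, else $0$; $g^+=g$, $g^-=1-g$; $1^\pm$ are the constants $1,0$; $(p^+\vee\pi^+)(S)=1$ iff $p\subseteq S$ or $S\subseteq\pi$. A Boolean degree $1$ function on $J_q(n,k)$ is $f:J_q(n,k)\to\{0,1\}$ of the form $f=c+\sum_p c_p p^+$ (real constants, sum over all points). It is trivial if it is one of $1^\pm$, $p^\pm$, $\pi^\pm$, $(p^+\vee\pi^+)^\pm$ with $p$ a point, $\pi$ a hyperplane and $p\notin\pi$. -}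

module Defs where

open import Level using (0ℓ)
open import Data.Nat using (ℕ; zero; suc; _^_; _≥_; _∸_)
open import Data.Nat.Primality using (Prime)
open import Data.Fin using (Fin)
import Data.Fin as F
open import Data.Bool using (Bool; true; false)
open import Data.Product using (Σ; ∃; _×_; _,_)
open import Data.Sum using (_⊎_)
open import Relation.Nullary using (¬_)
open import Relation.Binary.PropositionalEquality using (_≡_)
open import Algebra.Bundles using (CommutativeRing)
open import Function.Bundles using (Inverse; _⇔_)
import Relation.Binary.PropositionalEquality as ≡

IsPrimePower : ℕ → Set
IsPrimePower q = Σ ℕ λ p → Σ ℕ λ m → Prime p × m ≥ 1 × q ≡ p ^ m

record FiniteField (q : ℕ) : Set₁ where
  field
    commRing : CommutativeRing 0ℓ 0ℓ
  open CommutativeRing commRing public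
  field
    0≉1     : ¬ (0# ≈ 1#)
    inverse : ∀ x → ¬ (x ≈ 0#) → Σ Carrier λ y → x * y ≈ 1#
    enum    : Inverse setoid (≡.setoid (Fin q))

module Geometry {q : ℕ} (𝔽 : FiniteField q) where
  open FiniteField 𝔽

  Vec : ℕ → Set
  Vec n = Fin n → Carrier

  _≈ᵥ_ : ∀ {n} → Vec n → Vec n → Set
  u ≈ᵥ v = ∀ i → u i ≈ v i

  0ᵥ : ∀ {n} → Vec n
  0ᵥ _ = 0#

  _+ᵥ_ : ∀ {n} → Vec n → Vec n → Vec n
  (u +ᵥ v) i = u i + v i

  _·ᵥ_ : ∀ {n} → Carrier → Vec n → Vec n
  (c ·ᵥ v) i = c * v i

  linComb : ∀ {n k} → (Fin k → Carrier) → (Fin k → Vec n) → Vec n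
  linComb {k = zero}  c b = 0ᵥ
  linComb {k = suc k} c b = (c F.zero ·ᵥ b F.zero) +ᵥ linComb (λ i → c (F.suc i)) (λ i → b (F.suc i))

  record Subspace (n : ℕ) : Set₁ where
    field
      Mem     : Vec n → Set
      Mem-≈   : ∀ {u v} → u ≈ᵥ v → Mem u → Mem v
      Mem-0   : Mem 0ᵥ
      Mem-+   : ∀ {u v} → Mem u → Mem v → Mem (u +ᵥ v)
      Mem-·   : ∀ c {v} → Mem v → Mem (c ·ᵥ v)
  open Subspace public

  LinIndep : ∀ {n k} → (Fin k → Vec n) → Set
  LinIndep b = ∀ c → linComb c b ≈ᵥ 0ᵥ → ∀ i → c i ≈ 0#

  HasDim : ∀ {n} → Subspace n → ℕ → Set
  HasDim S k = Σ (Fin k → Vec _) λ b →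
    (∀ i → Mem S (b i)) × LinIndep b × (∀ v → Mem S v → Σ (Fin k → Carrier) λ c → v ≈ᵥ linComb c b)

  KSpace : ℕ → ℕ → Set₁
  KSpace n k = Σ (Subspace n) λ S → HasDim S k

  Point : ℕ → Set₁
  Point n = KSpace n 1

  Line : ℕ → Set₁
  Line n = KSpace n 2

  Hyperplane : ℕ → Set₁
  Hyperplane n = KSpace n (n ∸ 1)

  _⊆_ : ∀ {n d e} → KSpace n d → KSpace n e → Set
  (S , _) ⊆ (T , _) = ∀ v → Mem S v → Mem T v

  _≐_ : ∀ {n d e} → KSpace n d → KSpace n e → Set
  S ≐ T = S ⊆ T × T ⊆ S

  -- f (Boolean-valued) is the indicator g⁺ resp. g⁻ = 1 - g of a property Q
  Is⁺ : ∀ {n k} → (KSpace n k → Bool) → (KSpace n k → Set) → Set₁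
  Is⁺ f Q = ∀ K → (f K ≡ true ⇔ Q K)

  Is⁻ : ∀ {n k} → (KSpace n k → Bool) → (KSpace n k → Set) → Set₁
  Is⁻ f Q = ∀ K → (f K ≡ false ⇔ Q K)

  -- f is a trivial Boolean degree 1 function on J_q(n,k):
  -- one of 1^±, p^±, π^±, (p^+ ∨ π^+)^± with p ∉ π
  Trivial : ∀ {n k} → (KSpace n k → Bool) → Set₁
  Trivial {n} {k} f =
      (∀ K → f K ≡ true)
    ⊎ (∀ K → f K ≡ false)
    ⊎ (Σ (Point n) λ p → Is⁺ f (λ K → p ⊆ K))
    ⊎ (Σ (Point n) λ p → Is⁻ f (λ K → p ⊆ K))
    ⊎ (Σ (Hyperplane n) λ π → Is⁺ f (λ K → K ⊆ π))
    ⊎ (Σ (Hyperplane n) λ π → Is⁻ f (λ K → K ⊆ π))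
    ⊎ (Σ (Point n) λ p → Σ (Hyperplane n) λ π → ¬ (p ⊆ π) × Is⁺ f (λ K → p ⊆ K ⊎ K ⊆ π))
    ⊎ (Σ (Point n) λ p → Σ (Hyperplane n) λ π → ¬ (p ⊆ π) × Is⁻ f (λ K → p ⊆ K ⊎ K ⊆ π))

module Submission where

-- Fix w ∈ ℓ \ π, so that ℓ = ⟨w, a⟩.  The proof evaluates f on probes: k-spaces through
-- prescribed independent vectors, inside a prescribed space and avoiding prescribed vectors,
-- which exist as long as the dimensions leave room.  By hypothesis f = 1 on probes through a
-- inside π or through w, and f = 0 on off-π probes, which pass through a and some x ∉ π but
-- avoid w.  Testing each of the eight shapes of trivial functions on suitable probes refutes
-- seven of them; for f = p⁺ ∨ π'⁺ the probes force a ∈ π', p ∉ π, π = π' and p ∈ ℓ.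
--
-- Decidability of spans makes every case distinction constructive.

open import Defs
open import Data.Nat as ℕ using (ℕ; zero; suc; z≤n; s≤s; _∸_; _≥_)
import Data.Nat.Properties as ℕP
open import Data.Fin as F using (Fin; zero; suc; punchIn)
open import Data.Fin.Properties using (any?; all?)
open import Data.Vec.Functional using (Vector; []; _∷_; tail; insertAt; removeAt; foldr)
open import Data.Vec.Functional.Properties using (insertAt-lookup; insertAt-punchIn)
open import Data.Product using (Σ; _×_; _,_; proj₁; proj₂)
open import Data.Sum as Sum using (_⊎_; inj₁; inj₂)
open import Data.Empty using (⊥; ⊥-elim)
open import Data.Bool using (Bool; true; false)
open import Data.Maybe using (nothing)
open import Relation.Nullary using (¬_; Dec; yes; no; ¬?)
open import Relation.Nullary.Decidable using (map′; decidable-stable)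
open import Relation.Binary.PropositionalEquality as P using (_≡_)
import Relation.Binary.Reasoning.Setoid
open import Function.Base using (_∘_; case_of_)
open import Function.Bundles using (Inverse; Injection; mk⇔; Equivalence)
open import Function.Properties.Inverse using (Inverse⇒Injection)

module LinearAlgebra {q : ℕ} (𝔽 : FiniteField q) where
  open FiniteField 𝔽 hiding (zero)
  open Geometry 𝔽 public
  open import Algebra.Properties.Ring ring
    using (-‿involutive; -0#≈0#; -1*x≈-x; -‿distribˡ-*; -‿distribʳ-*; +-inverseʳ-unique)
  module Reasoning = Relation.Binary.Reasoning.Setoid setoid

  index : Carrier → Fin q
  index = Inverse.to enum

  element : Fin q → Carrier
  element = Inverse.from enum

  _≟_ : (x y : Carrier) → Dec (x ≈ y)
  x ≟ y = map′ (Injection.injective (Inverse⇒Injection enum)) (Inverse.to-cong enum) (index x F.≟ index y)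

  open import Algebra.Solver.Ring.NaturalCoefficients commutativeSemiring (λ _ _ → nothing)
    using (solve; _:+_; _:*_; _:=_)

  +-exchange : ∀ a b c → a + (b + c) ≈ b + (a + c)
  +-exchange = solve 3 (λ a b c → a :+ (b :+ c) := b :+ (a :+ c)) refl

  -1≉0 : ¬ (- 1# ≈ 0#)
  -1≉0 e = 0≉1 (sym (trans (sym (-‿involutive 1#)) (trans (-‿cong e) -0#≈0#)))

  Family : ℕ → ℕ → Set
  Family n k = Vector (Vec n) k

  module _ {n : ℕ} where
    ≈ᵥ-refl : {u : Vec n} → u ≈ᵥ u
    ≈ᵥ-refl i = refl

    ≈ᵥ-sym : {u v : Vec n} → u ≈ᵥ v → v ≈ᵥ u
    ≈ᵥ-sym e i = sym (e i)

    ≈ᵥ-trans : {u v w : Vec n} → u ≈ᵥ v → v ≈ᵥ w → u ≈ᵥ w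
    ≈ᵥ-trans e e' i = trans (e i) (e' i)

    linComb-cong : ∀ {k} {c d : Vector Carrier k} {b b' : Family n k} →
      (∀ i → c i ≈ d i) → (∀ i → b i ≈ᵥ b' i) → linComb c b ≈ᵥ linComb d b'
    linComb-cong {zero} ec eb j = refl
    linComb-cong {suc k} ec eb j =
      +-cong (*-cong (ec zero) (eb zero j)) (linComb-cong (λ i → ec (suc i)) (λ i → eb (suc i)) j)

    linComb-0 : ∀ {k} (b : Family n k) → linComb (λ _ → 0#) b ≈ᵥ 0ᵥ
    linComb-0 {zero} b j = refl
    linComb-0 {suc k} b j = trans (+-cong (zeroˡ (b zero j)) (linComb-0 (tail b) j)) (+-identityʳ 0#)

    linComb-+ : ∀ {k} (c d : Vector Carrier k) (b : Family n k) →
      linComb (λ i → c i + d i) b ≈ᵥ (linComb c b +ᵥ linComb d b)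
    linComb-+ {zero} c d b j = sym (+-identityʳ 0#)
    linComb-+ {suc k} c d b j =
      trans (+-cong refl (linComb-+ (tail c) (tail d) (tail b) j)) (interchange (c zero) (d zero) (b zero j) _ _)
      where
      interchange : ∀ x y z u v → (x + y) * z + (u + v) ≈ (x * z + u) + (y * z + v)
      interchange = solve 5 (λ x y z u v → (x :+ y) :* z :+ (u :+ v) := (x :* z :+ u) :+ (y :* z :+ v)) refl

    linComb-* : ∀ {k} (x : Carrier) (c : Vector Carrier k) (b : Family n k) →
      linComb (λ i → x * c i) b ≈ᵥ (x ·ᵥ linComb c b)
    linComb-* {zero} x c b j = sym (zeroʳ x)
    linComb-* {suc k} x c b j =
      trans (+-cong refl (linComb-* x (tail c) (tail b) j)) (factor x (c zero) (b zero j) _)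
      where
      factor : ∀ x y z u → (x * y) * z + x * u ≈ x * (y * z + u)
      factor = solve 4 (λ x y z u → (x :* y) :* z :+ x :* u := x :* (y :* z :+ u)) refl

    InSpan : ∀ {k} → Family n k → Vec n → Set
    InSpan {k} b v = Σ (Vector Carrier k) λ c → v ≈ᵥ linComb c b

    linComb-mem : ∀ {k} (S : Subspace n) (c : Vector Carrier k) (b : Family n k) →
      (∀ i → Mem S (b i)) → Mem S (linComb c b)
    linComb-mem {zero} S c b h = Mem-0 S
    linComb-mem {suc k} S c b h =
      Mem-+ S (Mem-· S (c zero) (h zero)) (linComb-mem S (tail c) (tail b) (λ i → h (suc i)))

    span : ∀ {k} → Family n k → Subspace n
    span b = record
      { Mem   = InSpan b
      ; Mem-≈ = λ { e (c , e') → c , ≈ᵥ-trans (≈ᵥ-sym e) e' }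
      ; Mem-0 = (λ _ → 0#) , ≈ᵥ-sym (linComb-0 b)
      ; Mem-+ = λ { (c , e) (d , e') → (λ i → c i + d i) ,
                    ≈ᵥ-trans (λ j → +-cong (e j) (e' j)) (≈ᵥ-sym (linComb-+ c d b)) }
      ; Mem-· = λ { x (c , e) → (λ i → x * c i) ,
                    ≈ᵥ-trans (λ j → *-cong refl (e j)) (≈ᵥ-sym (linComb-* x c b)) }
      }

    span-least : ∀ {k} (S : Subspace n) {b : Family n k} → (∀ i → Mem S (b i)) →
      ∀ {v} → InSpan b v → Mem S v
    span-least S {b} h (c , e) = Mem-≈ S (≈ᵥ-sym e) (linComb-mem S c b h)

    span-cons : ∀ {k} {b : Family n k} x {v} → InSpan b v → InSpan (x ∷ b) v
    span-cons x (c , e) = (0# ∷ c) , λ j → trans (e j) (sym (trans (+-cong (zeroˡ _) refl) (+-identityˡ _)))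

    span-gen : ∀ {k} (b : Family n k) i → InSpan b (b i)
    span-gen b zero = (1# ∷ λ _ → 0#) ,
      λ j → sym (trans (+-cong (*-identityˡ (b zero j)) (linComb-0 (tail b) j)) (+-identityʳ _))
    span-gen b (suc i) = span-cons (b zero) (span-gen (tail b) i)

  Mem-cancelʳ : ∀ {n} (S : Subspace n) {x y : Vec n} → Mem S (x +ᵥ y) → Mem S y → Mem S x
  Mem-cancelʳ S {x} {y} mxy my = Mem-≈ S difference (Mem-+ S mxy (Mem-· S (- 1#) my))
    where
    difference : ((x +ᵥ y) +ᵥ ((- 1#) ·ᵥ y)) ≈ᵥ x
    difference j = begin
      (x j + y j) + - 1# * y j ≈⟨ +-cong refl (-1*x≈-x (y j)) ⟩
      (x j + y j) + - y j      ≈⟨ +-assoc _ _ _ ⟩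
      x j + (y j + - y j)      ≈⟨ +-cong refl (-‿inverseʳ (y j)) ⟩
      x j + 0#                 ≈⟨ +-identityʳ _ ⟩
      x j                      ∎
      where open Reasoning

  Mem-cancelˡ : ∀ {n} (S : Subspace n) {x y : Vec n} → Mem S (x +ᵥ y) → Mem S x → Mem S y
  Mem-cancelˡ S mxy mx = Mem-cancelʳ S (Mem-≈ S (λ j → +-comm _ _) mxy) mx

  infix 4 _∋_
  _∋_ : ∀ {n d} → KSpace n d → Vec n → Set
  K ∋ v = Mem (proj₁ K) v

  module _ {n d : ℕ} (K : KSpace n d) where
    basis : Family n d
    basis = proj₁ (proj₂ K)

    basis-mem : ∀ i → K ∋ basis i
    basis-mem = proj₁ (proj₂ (proj₂ K))

    basis-indep : LinIndep basis
    basis-indep = proj₁ (proj₂ (proj₂ (proj₂ K)))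

    mem→span : ∀ {v} → K ∋ v → InSpan basis v
    mem→span {v} = proj₂ (proj₂ (proj₂ (proj₂ K))) v

    span→mem : ∀ {v} → InSpan basis v → K ∋ v
    span→mem = span-least (proj₁ K) basis-mem

  spanned : ∀ {n k} (T : Family n k) → LinIndep T → KSpace n k
  spanned T ind = span T , T , span-gen T , ind , λ v m → m

  solve-for : ∀ {c y x l} → c * y ≈ 1# → c * x + l ≈ 0# → x ≈ (- y) * l
  solve-for {c} {y} {x} {l} cy≈1 e = sym (begin
    (- y) * l           ≈⟨ *-cong refl (+-inverseʳ-unique _ _ e) ⟩
    (- y) * - (c * x)   ≈⟨ -‿distribˡ-* y _ ⟨
    - (y * - (c * x))   ≈⟨ -‿cong (-‿distribʳ-* y _) ⟨
    - - (y * (c * x))   ≈⟨ -‿involutive _ ⟩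
    y * (c * x)         ≈⟨ *-assoc y c x ⟨
    (y * c) * x         ≈⟨ *-cong (trans (*-comm y c) cy≈1) refl ⟩
    1# * x              ≈⟨ *-identityˡ x ⟩
    x                   ∎)
    where open Reasoning

  module _ {n : ℕ} where
    indep-tail : ∀ {m} {x : Vec n} {b : Family n m} → LinIndep (x ∷ b) → LinIndep b
    indep-tail ind c e i = ind (0# ∷ c) (λ j → trans (+-cong (zeroˡ _) (e j)) (+-identityʳ 0#)) (suc i)

    indep-head : ∀ {m} {x : Vec n} {b : Family n m} → LinIndep (x ∷ b) → ¬ InSpan b x
    indep-head {x = x} {b} ind (c , e) = -1≉0 (ind ((- 1#) ∷ c) vanishes zero)
      where
      vanishes : linComb ((- 1#) ∷ c) (x ∷ b) ≈ᵥ 0ᵥ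
      vanishes j = trans (+-cong (-1*x≈-x (x j)) (sym (e j))) (-‿inverseˡ (x j))

    indep-cons : ∀ {m} {x : Vec n} {b : Family n m} → LinIndep b → ¬ InSpan b x → LinIndep (x ∷ b)
    indep-cons {x = x} {b} ind x∉b c e with c zero ≟ 0# | inverse (c zero)
    ... | yes c₀≈0 | _ = λ { zero → c₀≈0 ; (suc i) → ind (tail c) rest i }
      where
      rest : linComb (tail c) b ≈ᵥ 0ᵥ
      rest j = trans (sym (trans (+-cong (trans (*-cong c₀≈0 refl) (zeroˡ _)) refl) (+-identityˡ _))) (e j)
    ... | no c₀≉0 | inv with inv c₀≉0
    ... | y , c₀y≈1 = ⊥-elim (x∉b ((λ i → (- y) * c (suc i)) ,
            λ j → trans (solve-for c₀y≈1 (e j)) (sym (linComb-* (- y) (tail c) b j))))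

    indep-single : ∀ {x : Vec n} → ¬ (x ≈ᵥ 0ᵥ) → LinIndep (x ∷ [])
    indep-single x≉0 = indep-cons {b = []} (λ c e ()) (λ { (c , e) → x≉0 e })

    indep-nonzero : ∀ {m} {u : Family n m} → LinIndep u → ∀ i → ¬ (u i ≈ᵥ 0ᵥ)
    indep-nonzero {u = u} ind zero e = 0≉1 (sym (ind (1# ∷ λ _ → 0#) vanishes zero))
      where
      vanishes : linComb (1# ∷ λ _ → 0#) u ≈ᵥ 0ᵥ
      vanishes j = trans (+-cong (trans (*-cong refl (e j)) (zeroʳ 1#)) (linComb-0 (tail u) j)) (+-identityʳ 0#)
    indep-nonzero {u = u} ind (suc i) = indep-nonzero (indep-tail {x = u zero} {b = tail u} ind) i

  -- A' ≼ A: every combination of A' is a combination of A whose coefficients vanish only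
  -- if those of A' do.  Independence passes from A to A'; we use it for reorderings.
  _≼_ : ∀ {n m m'} → Family n m → Family n m' → Set
  _≼_ {m = m} {m'} A' A = ∀ (c : Vector Carrier m) → Σ (Vector Carrier m') λ c' →
    (linComb c A' ≈ᵥ linComb c' A) × ((∀ i → c' i ≈ 0#) → ∀ i → c i ≈ 0#)

  module _ {n : ℕ} where
    indep-≼ : ∀ {m m'} {A' : Family n m} {A : Family n m'} → A' ≼ A → LinIndep A → LinIndep A'
    indep-≼ A'≼A ind c e with A'≼A c
    ... | c' , same , reflect = reflect (ind c' (≈ᵥ-trans (≈ᵥ-sym same) e))

    ≼-refl : ∀ {m} {A : Family n m} → A ≼ A
    ≼-refl c = c , ≈ᵥ-refl , λ z → z

    ≼-trans : ∀ {m m' m''} {A'' : Family n m''} {A' : Family n m} {A : Family n m'} →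
      A'' ≼ A' → A' ≼ A → A'' ≼ A
    ≼-trans h₁ h₂ c with h₁ c
    ... | c₁ , e₁ , z₁ with h₂ c₁
    ... | c₂ , e₂ , z₂ = c₂ , ≈ᵥ-trans e₁ e₂ , λ z → z₁ (z₂ z)

    ≼-cons : ∀ {m m'} {A' : Family n m} {A : Family n m'} x → A' ≼ A → (x ∷ A') ≼ (x ∷ A)
    ≼-cons x h c with h (tail c)
    ... | c' , e , z = (c zero ∷ c') , (λ j → +-cong refl (e j)) ,
      λ z' → λ { zero → z' zero ; (suc i) → z (λ i → z' (suc i)) i }

    ≼-swap : ∀ {m} {X : Family n m} y z → (y ∷ z ∷ X) ≼ (z ∷ y ∷ X)
    ≼-swap y z c = (c (suc zero) ∷ c zero ∷ tail (tail c)) , (λ j → +-exchange _ _ _) ,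
      λ z' → λ { zero → z' (suc zero) ; (suc zero) → z' zero ; (suc (suc i)) → z' (suc (suc i)) }

  -- Concatenation of families, by recursion on the first one (so that it computes on conses).
  infixr 5 _++_
  _++_ : ∀ {n r t} → Family n r → Family n t → Family n (r ℕ.+ t)
  _++_ {r = zero} Z T = T
  _++_ {r = suc r} Z T = Z zero ∷ (tail Z ++ T)

  module _ {n : ℕ} where
    ≼-move : ∀ {r t} (Z : Family n r) y (T : Family n t) → (Z ++ (y ∷ T)) ≼ (y ∷ (Z ++ T))
    ≼-move {zero} Z y T = ≼-refl {A = y ∷ T}
    ≼-move {suc r} Z y T = ≼-trans {A'' = Z ++ (y ∷ T)} {A' = Z zero ∷ y ∷ (tail Z ++ T)} {A = y ∷ (Z ++ T)}
      (≼-cons {A' = tail Z ++ (y ∷ T)} {A = y ∷ (tail Z ++ T)} (Z zero) (≼-move (tail Z) y T))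
      (≼-swap {X = tail Z ++ T} (Z zero) y)

    indep-++ʳ : ∀ {r t} (Z : Family n r) (T : Family n t) → LinIndep (Z ++ T) → LinIndep T
    indep-++ʳ {zero} Z T ind = ind
    indep-++ʳ {suc r} Z T ind = indep-++ʳ (tail Z) T (indep-tail {x = Z zero} ind)

    indep-++-avoid : ∀ {r t} (Z : Family n r) (T : Family n t) → LinIndep (Z ++ T) → ∀ j → ¬ InSpan T (Z j)
    indep-++-avoid {suc r} Z T ind zero s = indep-head {x = Z zero} ind (span-++ʳ (tail Z) s)
      where
      span-++ʳ : ∀ {r'} (Z' : Family n r') {v} → InSpan T v → InSpan (Z' ++ T) v
      span-++ʳ {zero} Z' s = s
      span-++ʳ {suc r'} Z' s = span-cons (Z' zero) (span-++ʳ (tail Z') s)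
    indep-++-avoid {suc r} Z T ind (suc j) = indep-++-avoid (tail Z) T (indep-tail {x = Z zero} ind) j

  module _ {n : ℕ} where
    linComb-removeAt : ∀ {m} (c : Vector Carrier (suc m)) (u : Family n (suc m)) i →
      linComb c u ≈ᵥ ((c i ·ᵥ u i) +ᵥ linComb (removeAt c i) (removeAt u i))
    linComb-removeAt c u zero = ≈ᵥ-refl
    linComb-removeAt {suc m} c u (suc i) j =
      trans (+-cong refl (linComb-removeAt (tail c) (tail u) i j)) (+-exchange _ _ _)

    linComb-affine : ∀ {m} (d s : Vector Carrier m) (v : Family n m) (x : Vec n) →
      linComb d (λ j → v j +ᵥ (s j ·ᵥ x)) ≈ᵥ (linComb d v +ᵥ (foldr _+_ 0# (λ j → d j * s j) ·ᵥ x))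
    linComb-affine {zero} d s v x j = sym (trans (+-cong refl (zeroˡ _)) (+-identityʳ _))
    linComb-affine {suc m} d s v x j =
      trans (+-cong refl (linComb-affine (tail d) (tail s) (tail v) x j)) (regroup _ _ _ _ _ _)
      where
      regroup : ∀ d v s x B S → d * (v + s * x) + (B + S * x) ≈ (d * v + B) + (d * s + S) * x
      regroup = solve 6 (λ d v s x B S →
        d :* (v :+ s :* x) :+ (B :+ S :* x) := (d :* v :+ B) :+ (d :* s :+ S) :* x) refl

    indep-eliminate : ∀ {m} {u : Family n (suc m)} → LinIndep u → ∀ i (s : Vector Carrier m) →
      LinIndep (λ j → removeAt u i j +ᵥ (s j ·ᵥ u i))
    indep-eliminate {u = u} ind i s d e j =
      trans (reflexive (P.sym (insertAt-punchIn d i S j))) (ind c vanishes (punchIn i j))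
      where
      S = foldr _+_ 0# (λ j → d j * s j)
      c = insertAt d i S
      vanishes : linComb c u ≈ᵥ 0ᵥ
      vanishes t = begin
        linComb c u t
          ≈⟨ linComb-removeAt c u i t ⟩
        c i * u i t + linComb (removeAt c i) (removeAt u i) t
          ≈⟨ +-cong (*-cong (reflexive (insertAt-lookup d i S)) refl)
                    (linComb-cong (λ j → reflexive (insertAt-punchIn d i S j)) (λ _ → ≈ᵥ-refl) t) ⟩
        S * u i t + linComb d (removeAt u i) t
          ≈⟨ +-comm _ _ ⟩
        linComb d (removeAt u i) t + S * u i t
          ≈⟨ linComb-affine d s (removeAt u i) (u i) t ⟨
        linComb d (λ j → removeAt u i j +ᵥ (s j ·ᵥ u i)) t
          ≈⟨ e t ⟩
        0# ∎
        where open Reasoning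

    span-drop-head : ∀ {r} (w : Family n (suc r)) {v} ((c , _) : InSpan w v) → c zero ≈ 0# → InSpan (tail w) v
    span-drop-head w (c , e) c₀≈0 = tail c ,
      λ j → trans (e j) (trans (+-cong (trans (*-cong c₀≈0 refl) (zeroˡ _)) refl) (+-identityˡ _))

    -- One step of Gaussian elimination: if the coefficient of u i on w zero is nonzero, then
    -- suitable multiples of u i added to the other u j bring them into the span of tail w.
    eliminate-head : ∀ {m r} (u : Family n (suc m)) (w : Family n (suc r)) (h : ∀ j → InSpan w (u j)) i →
      ¬ (proj₁ (h i) zero ≈ 0#) →
      Σ (Vector Carrier m) λ s → ∀ j → InSpan (tail w) (removeAt u i j +ᵥ (s j ·ᵥ u i))
    eliminate-head u w h i αᵢ≉0 with inverse (proj₁ (h i) zero) αᵢ≉0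
    ... | y , αᵢy≈1 = s , λ j → span-drop-head w (combined j) (head-cancels j)
      where
      C = λ j → proj₁ (h j)
      α = λ j → C j zero
      s = λ j → - (α (punchIn i j) * y)
      combined : ∀ j → InSpan w (removeAt u i j +ᵥ (s j ·ᵥ u i))
      combined j = (λ t → C (punchIn i j) t + s j * C i t) ,
        λ x → trans (+-cong (proj₂ (h (punchIn i j)) x) (*-cong refl (proj₂ (h i) x)))
                    (sym (trans (linComb-+ (C (punchIn i j)) (λ t → s j * C i t) w x)
                                (+-cong refl (linComb-* (s j) (C i) w x))))
      head-cancels : ∀ j → α (punchIn i j) + s j * α i ≈ 0#
      head-cancels j = begin
        a + - (a * y) * α i   ≈⟨ +-cong refl (-‿distribˡ-* _ _) ⟨
        a + - ((a * y) * α i) ≈⟨ +-cong refl (-‿cong (*-assoc a y (α i))) ⟩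
        a + - (a * (y * α i)) ≈⟨ +-cong refl (-‿cong (*-cong refl (trans (*-comm y (α i)) αᵢy≈1))) ⟩
        a + - (a * 1#)        ≈⟨ +-cong refl (-‿cong (*-identityʳ a)) ⟩
        a + - a               ≈⟨ -‿inverseʳ a ⟩
        0#                    ∎
        where
        open Reasoning
        a = α (punchIn i j)

    steinitz : ∀ {m r} (u : Family n m) (w : Family n r) → LinIndep u → (∀ j → InSpan w (u j)) → m ℕ.≤ r
    steinitz {zero} u w ind h = z≤n
    steinitz {suc m} {zero} u w ind h = ⊥-elim (indep-nonzero {u = u} ind zero (proj₂ (h zero)))
    steinitz {suc m} {suc r} u w ind h with any? (λ j → ¬? (proj₁ (h j) zero ≟ 0#))
    ... | yes (i , αᵢ≉0) with eliminate-head u w h i αᵢ≉0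
    ...   | s , h' = s≤s (steinitz _ (tail w) (indep-eliminate {u = u} ind i s) h')
    steinitz {suc m} {suc r} u w ind h | no none =
      ℕP.m≤n⇒m≤1+n (steinitz u (tail w) ind λ j →
        span-drop-head w (h j) (decidable-stable (_ ≟ 0#) (λ αⱼ≉0 → none (j , αⱼ≉0))))

  -- The existence proofs below search the finite field; they are opaque so that type
  -- checking never unfolds them.
  opaque
    -- Over a finite field one may search through all coefficient vectors, so spans are decidable.
    search : ∀ k (P : Vector Carrier k → Set) → (∀ {c d} → (∀ i → c i ≈ d i) → P c → P d) →
      (∀ c → Dec (P c)) → Dec (Σ (Vector Carrier k) P)
    search zero P resp P? with P? (λ ())
    ... | yes p = yes (_ , p)
    ... | no ¬p = no λ { (c , p) → ¬p (resp (λ ()) p) }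
    search (suc k) P resp P? with any? (λ i → search k (λ c → P (element i ∷ c))
                                    (λ eq → resp λ { zero → refl ; (suc j) → eq j })
                                    (λ c → P? (element i ∷ c)))
    ... | yes (i , c , p) = yes (_ , p)
    ... | no none = no λ { (c , p) → none (index (c zero) , tail c ,
            resp (λ { zero → sym (Inverse.strictlyInverseʳ enum (c zero)) ; (suc j) → refl }) p) }

    dec-span : ∀ {n k} (b : Family n k) v → Dec (InSpan b v)
    dec-span {k = k} b v = search k (λ c → v ≈ᵥ linComb c b)
      (λ eq h j → trans (h j) (linComb-cong eq (λ _ → ≈ᵥ-refl) j))
      (λ c → all? (λ j → v j ≟ linComb c b j))

  dec-mem : ∀ {n d} (K : KSpace n d) v → Dec (K ∋ v)
  dec-mem K v = map′ (span→mem K) (mem→span K) (dec-span (basis K) v)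

  module _ {n : ℕ} where
    indep-spans : ∀ {d d'} (β : Family n d) (b : Family n d') → d ℕ.≤ d' → LinIndep b →
      (∀ i → InSpan β (b i)) → ∀ {v} → InSpan β v → InSpan b v
    indep-spans β b d≤d' ind b⊆β {v} v∈β with dec-span b v
    ... | yes v∈b = v∈b
    ... | no v∉b = ⊥-elim (ℕP.<⇒≱ (s≤s d≤d')
            (steinitz (v ∷ b) β (indep-cons ind v∉b) λ { zero → v∈β ; (suc i) → b⊆β i }))

    outside : ∀ {d t} (β : Family n d) → LinIndep β → (F : Family n t) → t ℕ.< d →
      Σ (Fin d) λ i → ¬ InSpan F (β i)
    outside β ind F t<d with any? (λ i → ¬? (dec-span F (β i)))
    ... | yes found = found
    ... | no none = ⊥-elim (ℕP.<⇒≱ t<d (steinitz β F ind λ i →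
            decidable-stable (dec-span F (β i)) (λ β∉F → none (i , β∉F))))

  opaque
    outside-space : ∀ {n d t} (W : KSpace n d) (F : Family n t) → t ℕ.< d → Σ (Vec n) λ v → W ∋ v × ¬ InSpan F v
    outside-space W F t<d with outside (basis W) (basis-indep W) F t<d
    ... | i , ∉F = basis W i , basis-mem W i , ∉F

  same-dim-⊆ : ∀ {n d} (S T : KSpace n d) → S ⊆ T → T ⊆ S
  same-dim-⊆ S T S⊆T v v∈T = span→mem S (indep-spans (basis T) (basis S) ℕP.≤-refl (basis-indep S)
    (λ i → mem→span T (S⊆T _ (basis-mem S i))) (mem→span T v∈T))

  opaque
    ⊈-witness : ∀ {n d e} (S : KSpace n d) (T : KSpace n e) → ¬ S ⊆ T → Σ (Vec n) λ v → S ∋ v × ¬ T ∋ v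
    ⊈-witness S T S⊈T with any? (λ i → ¬? (dec-mem T (basis S i)))
    ... | yes (i , ∉T) = basis S i , basis-mem S i , ∉T
    ... | no none = ⊥-elim (S⊈T λ v v∈S → span-least (proj₁ T)
            (λ i → decidable-stable (dec-mem T (basis S i)) (λ ∉T → none (i , ∉T))) (mem→span S v∈S))

    fresh : ∀ {n d e t} (W : KSpace n d) (Q : KSpace n e) {z} → W ∋ z → ¬ Q ∋ z →
      (F : Family n t) → InSpan F z → t ℕ.< d → Σ (Vec n) λ x → W ∋ x × ¬ Q ∋ x × ¬ InSpan F x
    fresh W Q {z} z∈W z∉Q F z∈F t<d with outside-space W F t<d
    ... | v , v∈W , v∉F with dec-mem Q v
    ...   | no v∉Q = v , v∈W , v∉Q , v∉F
    ...   | yes v∈Q = (z +ᵥ v) , Mem-+ (proj₁ W) z∈W v∈W ,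
            (λ z+v∈Q → z∉Q (Mem-cancelʳ (proj₁ Q) z+v∈Q v∈Q)) ,
            (λ z+v∈F → v∉F (Mem-cancelˡ (span F) z+v∈F z∈F))

  +-suc-< : ∀ {r m d} → r ℕ.+ suc m ℕ.≤ d → r ℕ.+ m ℕ.< d
  +-suc-< {r} {m} {d} = P.subst (ℕ._≤ d) (ℕP.+-suc r m)

  module _ {n d r : ℕ} (W : KSpace n d) (Z : Family n r) where
    opaque
      extend : ∀ j {t} m (T : Family n t) → m ≡ j ℕ.+ t → r ℕ.+ m ℕ.≤ d →
        LinIndep (Z ++ T) → (∀ i → W ∋ T i) →
        Σ (Family n m) λ T' → LinIndep (Z ++ T') × (∀ i → W ∋ T' i) × (∀ i → InSpan T' (T i))
      extend zero m T P.refl fits ind T⊆W = T , ind , T⊆W , span-gen T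
      extend (suc j) {t} .(suc (j ℕ.+ t)) T P.refl fits ind T⊆W
        with extend j (j ℕ.+ t) T P.refl (ℕP.<⇒≤ (+-suc-< fits)) ind T⊆W
      ... | T' , ind' , T'⊆W , T⊆T' with outside-space W (Z ++ T') (+-suc-< fits)
      ...   | y , y∈W , y∉ZT' =
        (y ∷ T') ,
        indep-≼ {A' = Z ++ (y ∷ T')} {A = y ∷ (Z ++ T')} (≼-move Z y T') (indep-cons ind' y∉ZT') ,
        (λ { zero → y∈W ; (suc i) → T'⊆W i }) ,
        (λ i → span-cons y (T⊆T' i))

  record Probe {n d r t} (k : ℕ) (W : KSpace n d) (Z : Family n r) (S : Family n t) : Set₁ where
    field
      K        : KSpace n k
      K⊆W      : K ⊆ W
      contains : ∀ i → K ∋ S i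
      avoids   : ∀ j → ¬ K ∋ Z j

  opaque
    probe : ∀ {n d r t} k (W : KSpace n d) (Z : Family n r) (S : Family n t) →
      (∀ j → W ∋ Z j) → (∀ i → W ∋ S i) → LinIndep (Z ++ S) → t ℕ.≤ k → r ℕ.+ k ℕ.≤ d →
      Probe k W Z S
    probe {t = t} k W Z S Z⊆W S⊆W ind t≤k fits
      with extend W Z (k ∸ t) k S (P.sym (ℕP.m∸n+n≡m t≤k)) fits ind S⊆W
    ... | T , ind' , T⊆W , S⊆T = record
      { K        = spanned T (indep-++ʳ Z T ind')
      ; K⊆W      = λ v → span-least (proj₁ W) T⊆W
      ; contains = S⊆T
      ; avoids   = indep-++-avoid Z T ind'
      }

  e : ∀ {n} → Family n n
  e zero zero = 1#
  e zero (suc j) = 0#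
  e (suc i) zero = 0#
  e (suc i) (suc j) = e i j

  module _ {n : ℕ} where
    linComb-head : ∀ {k} (c : Vector Carrier k) (b : Family (suc n) k) →
      (∀ i → b i zero ≈ 0#) → linComb c b zero ≈ 0#
    linComb-head {zero} c b h = refl
    linComb-head {suc k} c b h =
      trans (+-cong (trans (*-cong refl (h zero)) (zeroʳ _)) (linComb-head (tail c) (tail b) (h ∘ suc))) (+-identityʳ _)

    linComb-tail : ∀ {k} (c : Vector Carrier k) (b : Family (suc n) k) j →
      linComb c b (suc j) ≈ linComb c (λ i → tail (b i)) j
    linComb-tail {zero} c b j = refl
    linComb-tail {suc k} c b j = +-cong refl (linComb-tail (tail c) (tail b) j)

  linComb-e : ∀ {n} (c : Vec n) → linComb c e ≈ᵥ c
  linComb-e {suc n} c zero =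
    trans (+-cong (*-identityʳ _) (linComb-head (tail c) (tail e) (λ i → refl))) (+-identityʳ _)
  linComb-e {suc n} c (suc j) =
    trans (+-cong (zeroʳ _) (trans (linComb-tail (tail c) (tail e) j) (linComb-e (tail c) j))) (+-identityˡ _)

  whole : ∀ {n} → KSpace n n
  whole = spanned e (λ c c≈0 j → trans (sym (linComb-e c j)) (c≈0 j))

  everything : ∀ {n} (v : Vec n) → whole ∋ v
  everything v = v , ≈ᵥ-sym (linComb-e v)

  vec : ∀ {n} → Point n → Vec n
  vec p = basis p zero

  vec-nonzero : ∀ {n} (p : Point n) → ¬ (vec p ≈ᵥ 0ᵥ)
  vec-nonzero p = indep-nonzero {u = basis p} (basis-indep p) zero

  ⊆→∋ : ∀ {n d} (p : Point n) (K : KSpace n d) → p ⊆ K → K ∋ vec p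
  ⊆→∋ p K p⊆K = p⊆K (vec p) (basis-mem p zero)

  ∋→⊆ : ∀ {n d} (p : Point n) (K : KSpace n d) → K ∋ vec p → p ⊆ K
  ∋→⊆ p K v∈K v v∈p = span-least (proj₁ K) {b = basis p} (λ { zero → v∈K }) (mem→span p v∈p)

clash : ∀ {b : Bool} → b ≡ true → b ≡ false → ⊥
clash P.refl ()

≤-∸1 : ∀ {a m} → suc a ℕ.≤ m → a ℕ.≤ m ∸ 1
≤-∸1 (s≤s a≤m) = a≤m

module Proof {q : ℕ} (𝔽 : FiniteField q) where
  open FiniteField 𝔽 hiding (zero)
  open LinearAlgebra 𝔽

  module Situation
    (n k : ℕ) (k≥2 : k ≥ 2) (n≥2k : n ≥ 2 ℕ.* k) (f : KSpace n k → Bool)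
    (π : Hyperplane n) (a : Point n) (ℓ : Line n) (a⊆π : a ⊆ π) (ℓ⊈π : ¬ (ℓ ⊆ π)) (a⊆ℓ : a ⊆ ℓ)
    (H : ∀ (K : KSpace n k) → a ⊆ K →
           (K ⊆ π → f K ≡ true) × (ℓ ⊆ K → f K ≡ true) × (¬ (K ⊆ π) → ¬ (ℓ ⊆ K) → f K ≡ false))
    where
    open Probe

    -- Dimension bookkeeping: n ≥ 2k ≥ k + 2 ≥ 4 leaves room for every probe below.
    k+2≤n : 2 ℕ.+ k ℕ.≤ n
    k+2≤n = ℕP.≤-trans (ℕP.+-monoˡ-≤ k k≥2) (P.subst (λ m → k ℕ.+ m ℕ.≤ n) (ℕP.+-identityʳ k) n≥2k)

    4≤n : 4 ℕ.≤ n
    4≤n = ℕP.≤-trans (ℕP.+-monoʳ-≤ 2 k≥2) k+2≤n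

    fits-whole : ∀ {r} → r ℕ.≤ 2 → r ℕ.+ k ℕ.≤ n
    fits-whole r≤2 = ℕP.≤-trans (ℕP.+-monoˡ-≤ k r≤2) k+2≤n

    fits-hyperplane : ∀ {r} → r ℕ.≤ 1 → r ℕ.+ k ℕ.≤ n ∸ 1
    fits-hyperplane r≤1 = ≤-∸1 (fits-whole (s≤s r≤1))

    at-most-k : ∀ {t} → t ℕ.≤ 2 → t ℕ.≤ k
    at-most-k t≤2 = ℕP.≤-trans t≤2 k≥2

    two<n-1 : 2 ℕ.< n ∸ 1
    two<n-1 = ≤-∸1 4≤n

    a₀ : Vec n
    a₀ = vec a

    a₀∈π : π ∋ a₀
    a₀∈π = ⊆→∋ a π a⊆π

    a₀∈ℓ : ℓ ∋ a₀
    a₀∈ℓ = ⊆→∋ a ℓ a⊆ℓ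

    indep-a : LinIndep (a₀ ∷ [])
    indep-a = indep-single (vec-nonzero a)

    w-choice : Σ (Vec n) λ w → ℓ ∋ w × ¬ π ∋ w
    w-choice = ⊈-witness ℓ π ℓ⊈π

    w : Vec n
    w = proj₁ w-choice

    w∈ℓ : ℓ ∋ w
    w∈ℓ = proj₁ (proj₂ w-choice)

    w∉π : ¬ π ∋ w
    w∉π = proj₂ (proj₂ w-choice)

    ⟨a⟩-⊆ : ∀ {d} (K : KSpace n d) → K ∋ a₀ → ∀ {u} → InSpan (a₀ ∷ []) u → K ∋ u
    ⟨a⟩-⊆ K a₀∈K = span-least (proj₁ K) {b = a₀ ∷ []} λ { zero → a₀∈K }

    ⟨w,a⟩-⊆ : ∀ {d} (K : KSpace n d) → K ∋ w → K ∋ a₀ → ∀ {u} → InSpan (w ∷ a₀ ∷ []) u → K ∋ u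
    ⟨w,a⟩-⊆ K w∈K a₀∈K =
      span-least (proj₁ K) {b = w ∷ a₀ ∷ []} λ { zero → w∈K ; (suc zero) → a₀∈K }

    indep-wa : LinIndep (w ∷ a₀ ∷ [])
    indep-wa = indep-cons {x = w} {b = a₀ ∷ []} indep-a (λ w∈⟨a⟩ → w∉π (⟨a⟩-⊆ π a₀∈π w∈⟨a⟩))

    ℓ⊆⟨w,a⟩ : ∀ {v} → ℓ ∋ v → InSpan (w ∷ a₀ ∷ []) v
    ℓ⊆⟨w,a⟩ v∈ℓ = indep-spans (basis ℓ) (w ∷ a₀ ∷ []) ℕP.≤-refl indep-wa
      (λ { zero → mem→span ℓ w∈ℓ ; (suc zero) → mem→span ℓ a₀∈ℓ }) (mem→span ℓ v∈ℓ)

    f-inside : (K : KSpace n k) → K ∋ a₀ → K ⊆ π → f K ≡ true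
    f-inside K a₀∈K = proj₁ (H K (∋→⊆ a K a₀∈K))

    f-line : (K : KSpace n k) → K ∋ a₀ → K ∋ w → f K ≡ true
    f-line K a₀∈K w∈K =
      proj₁ (proj₂ (H K (∋→⊆ a K a₀∈K))) λ v v∈ℓ → ⟨w,a⟩-⊆ K w∈K a₀∈K (ℓ⊆⟨w,a⟩ v∈ℓ)

    f-off : ∀ {x} (K : KSpace n k) → K ∋ a₀ → K ∋ x → ¬ π ∋ x → ¬ K ∋ w → f K ≡ false
    f-off K a₀∈K x∈K x∉π w∉K =
      proj₂ (proj₂ (H K (∋→⊆ a K a₀∈K)))
        (λ K⊆π → x∉π (K⊆π _ x∈K)) (λ ℓ⊆K → w∉K (ℓ⊆K w w∈ℓ))

    inside-probe : Probe k π [] (a₀ ∷ [])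
    inside-probe = probe k π [] (a₀ ∷ []) (λ ()) (λ { zero → a₀∈π }) indep-a
      (at-most-k (s≤s z≤n)) (fits-hyperplane z≤n)

    inside-true : f (K inside-probe) ≡ true
    inside-true = f-inside (K inside-probe) (contains inside-probe zero) (K⊆W inside-probe)

    inside-through : ∀ {u} → π ∋ u → ¬ InSpan (a₀ ∷ []) u → Probe k π [] (u ∷ a₀ ∷ [])
    inside-through {u} u∈π u∉⟨a⟩ =
      probe k π [] (u ∷ a₀ ∷ []) (λ ()) (λ { zero → u∈π ; (suc zero) → a₀∈π })
      (indep-cons {x = u} {b = a₀ ∷ []} indep-a u∉⟨a⟩) (at-most-k ℕP.≤-refl) (fits-hyperplane z≤n)

    line-probe : Probe k whole [] (w ∷ a₀ ∷ [])
    line-probe = probe k whole [] (w ∷ a₀ ∷ []) (λ ()) (λ _ → everything _) indep-wa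
      (at-most-k ℕP.≤-refl) (fits-whole z≤n)

    line-true : f (K line-probe) ≡ true
    line-true = f-line (K line-probe) (contains line-probe (suc zero)) (contains line-probe zero)

    -- Off-π probes: k-spaces of W through a and some x ∉ π, avoiding w (hence not
    -- containing ℓ) and the vectors Z.  By hypothesis f = 0 on them.
    OffProbe : ∀ {d r} → KSpace n d → Family n r → Vec n → Set₁
    OffProbe W Z x = Probe k W (w ∷ Z) (x ∷ a₀ ∷ [])

    off-probe : ∀ {d r} (W : KSpace n d) (Z : Family n r) {x} → W ∋ w → (∀ j → W ∋ Z j) → W ∋ x →
      W ∋ a₀ → LinIndep (x ∷ ((w ∷ Z) ++ (a₀ ∷ []))) → suc r ℕ.+ k ℕ.≤ d → OffProbe W Z x
    off-probe W Z {x} w∈W Z⊆W x∈W a₀∈W ind fits = probe k W (w ∷ Z) (x ∷ a₀ ∷ [])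
      (λ { zero → w∈W ; (suc j) → Z⊆W j }) (λ { zero → x∈W ; (suc zero) → a₀∈W })
      (indep-≼ {A' = (w ∷ Z) ++ (x ∷ a₀ ∷ [])} {A = x ∷ ((w ∷ Z) ++ (a₀ ∷ []))}
        (≼-move (w ∷ Z) x (a₀ ∷ [])) ind)
      (at-most-k ℕP.≤-refl) fits

    f-off-probe : ∀ {d r} {W : KSpace n d} {Z : Family n r} {x} (P : OffProbe W Z x) → ¬ π ∋ x →
      f (K P) ≡ false
    f-off-probe P x∉π = f-off (K P) (contains P (suc zero)) (contains P zero) x∉π (avoids P zero)

    AvoidBase : ∀ {r} → Family n r → Family n (suc (r ℕ.+ 1))
    AvoidBase Z = (w ∷ Z) ++ (a₀ ∷ [])

    off-probe-at : ∀ {r} (Z : Family n r) {x} → r ℕ.≤ 1 → LinIndep (AvoidBase Z) →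
      ¬ InSpan (AvoidBase Z) x → OffProbe whole Z x
    off-probe-at Z {x} r≤1 ind x∉F = off-probe whole Z (everything w) (λ _ → everything _)
      (everything x) (everything a₀) (indep-cons {x = x} {b = AvoidBase Z} ind x∉F) (fits-whole (s≤s r≤1))

    fresh-off : ∀ {t} (F : Family n t) → InSpan F w → t ℕ.< n → Σ (Vec n) λ x → ¬ π ∋ x × ¬ InSpan F x
    fresh-off F w∈F t<n = case fresh whole π (everything w) w∉π F w∈F t<n of λ where
      (x , _ , x∉π , x∉F) → x , x∉π , x∉F

    avoid-base<n : ∀ {r} → r ℕ.≤ 1 → suc (r ℕ.+ 1) ℕ.< n
    avoid-base<n r≤1 = ℕP.≤-trans (s≤s (s≤s (ℕP.+-monoˡ-≤ 1 r≤1))) 4≤n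

    some-off-probe : ∀ {r} (Z : Family n r) → r ℕ.≤ 1 → LinIndep (AvoidBase Z) →
      Σ (Vec n) λ x → ¬ π ∋ x × OffProbe whole Z x
    some-off-probe Z r≤1 ind =
      case fresh-off (AvoidBase Z) (span-gen (AvoidBase Z) zero) (avoid-base<n r≤1) of λ where
        (x , x∉π , x∉F) → x , x∉π , off-probe-at Z r≤1 ind x∉F

    indep-wua : ∀ {u} → ¬ InSpan (w ∷ a₀ ∷ []) u → LinIndep (AvoidBase (u ∷ []))
    indep-wua {u} u∉ℓ =
      indep-≼ {A' = w ∷ u ∷ a₀ ∷ []} {A = u ∷ w ∷ a₀ ∷ []} (≼-swap {X = a₀ ∷ []} w u)
      (indep-cons {x = u} {b = w ∷ a₀ ∷ []} indep-wa u∉ℓ)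

    -- If all off-π probes avoiding Z lie in Q, so does every c ∈ π admitting some x ∉ π
    -- with x and x + c outside the span of w, Z, a₀: use the probes through x and x + c.
    OffInside : ∀ {r e} → Family n r → KSpace n e → Set₁
    OffInside Z Q = ∀ {x} (P : OffProbe whole Z x) → ¬ π ∋ x → K P ⊆ Q

    transfer : ∀ {r e} {Z : Family n r} {Q : KSpace n e} → OffInside Z Q → r ℕ.≤ 1 →
      LinIndep (AvoidBase Z) → ∀ {c x} → π ∋ c → ¬ π ∋ x →
      ¬ InSpan (AvoidBase Z) x → ¬ InSpan (AvoidBase Z) (x +ᵥ c) → Q ∋ c
    transfer {Z = Z} {Q} off⊆Q r≤1 ind {c} {x} c∈π x∉π x∉F x+c∉F =
      Mem-cancelˡ (proj₁ Q) (off⊆Q P₂ x+c∉π _ (contains P₂ zero)) (off⊆Q P₁ x∉π _ (contains P₁ zero))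
      where
      P₁ = off-probe-at Z r≤1 ind x∉F
      P₂ = off-probe-at Z r≤1 ind x+c∉F
      x+c∉π : ¬ π ∋ (x +ᵥ c)
      x+c∉π x+c∈π = x∉π (Mem-cancelʳ (proj₁ π) x+c∈π c∈π)

    transfer-span : ∀ {r e} {Z : Family n r} {Q : KSpace n e} → OffInside Z Q → r ℕ.≤ 1 →
      LinIndep (AvoidBase Z) → ∀ {c} → π ∋ c → InSpan (AvoidBase Z) c → Q ∋ c
    transfer-span {Z = Z} {Q} off⊆Q r≤1 ind {c} c∈π c∈F =
      case fresh-off (AvoidBase Z) (span-gen (AvoidBase Z) zero) (avoid-base<n r≤1) of λ where
        (x , x∉π , x∉F) → transfer {Z = Z} {Q = Q} off⊆Q r≤1 ind {c} {x} c∈π x∉π x∉F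
          (λ x+c∈F → x∉F (Mem-cancelʳ (span (AvoidBase Z)) x+c∈F c∈F))

    transfer-all : ∀ {r e} {Z : Family n r} {Q : KSpace n e} → OffInside Z Q → r ℕ.≤ 1 →
      LinIndep (AvoidBase Z) → suc (suc (r ℕ.+ 1)) ℕ.< n → π ⊆ Q
    transfer-all {Z = Z} {Q} off⊆Q r≤1 ind room c c∈π =
      case fresh-off cF (span-cons {b = F} c (span-gen F zero)) room of λ where
        (x , x∉π , x∉cF) → transfer {Z = Z} {Q = Q} off⊆Q r≤1 ind {c} {x} c∈π x∉π
          (λ x∈F → x∉cF (span-cons {b = F} c x∈F))
          (λ x+c∈F → x∉cF (Mem-cancelʳ (span cF) (span-cons {b = F} c x+c∈F) (span-gen cF zero)))
      where
      F = AvoidBase Z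
      cF = c ∷ F

    -- f = 1 fails on off-π probes.
    not-one : ¬ (∀ K → f K ≡ true)
    not-one all-true = case some-off-probe [] z≤n indep-wa of λ where
      (x , x∉π , P) → clash (all-true (K P)) (f-off-probe P x∉π)

    -- f = 0 fails inside π.
    not-zero : ¬ (∀ K → f K ≡ false)
    not-zero all-false = clash inside-true (all-false (K inside-probe))

    inside-avoiding : ∀ {u} → π ∋ u → ¬ InSpan (a₀ ∷ []) u → Probe k π (u ∷ []) (a₀ ∷ [])
    inside-avoiding {u} u∈π u∉⟨a⟩ =
      probe k π (u ∷ []) (a₀ ∷ []) (λ { zero → u∈π }) (λ { zero → a₀∈π })
      (indep-cons {x = u} {b = a₀ ∷ []} indep-a u∉⟨a⟩) (at-most-k (s≤s z≤n)) (fits-hyperplane (s≤s z≤n))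

    -- On the k-spaces through a, f is not the indicator of containing a given vector u:
    -- if u ∉ π it is missed by a space inside π, if u ∈ ⟨a⟩ it lies in the off-π probes, and
    -- otherwise it is missed by a space inside π avoiding it.
    not-indicator : ∀ u → (∀ K → K ∋ a₀ → f K ≡ true → K ∋ u) →
                          (∀ K → K ∋ a₀ → K ∋ u → f K ≡ true) → ⊥
    not-indicator u true⇒u u⇒true = case dec-mem π u of λ where
      (no u∉π) → u∉π (K⊆W inside-probe u (true⇒u _ (contains inside-probe zero) inside-true))
      (yes u∈π) → case dec-span (a₀ ∷ []) u of λ where
        (yes u∈⟨a⟩) → case some-off-probe [] z≤n indep-wa of λ where
          (x , x∉π , P) → clash (u⇒true (K P) (contains P (suc zero))
                                   (⟨a⟩-⊆ (K P) (contains P (suc zero)) u∈⟨a⟩))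
                                (f-off-probe P x∉π)
        (no u∉⟨a⟩) → let P = inside-avoiding u∈π u∉⟨a⟩ in
          avoids P zero (true⇒u (K P) (contains P zero) (f-inside (K P) (contains P zero) (K⊆W P)))

    -- f = p⁺ is such an indicator.
    not-point⁺ : (p : Point n) → ¬ Is⁺ f (λ K → p ⊆ K)
    not-point⁺ p h = not-indicator (vec p)
      (λ K _ fK → ⊆→∋ p K (Equivalence.to (h K) fK)) (λ K _ u∈K → Equivalence.from (h K) (∋→⊆ p K u∈K))

    line-through : ∀ {u} → InSpan (w ∷ a₀ ∷ []) u → K line-probe ∋ u
    line-through = ⟨w,a⟩-⊆ (K line-probe) (contains line-probe zero) (contains line-probe (suc zero))

    -- f = p⁻ fails on the line probe if p ∈ ℓ, and otherwise on an off-π probe avoiding p.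
    not-point⁻ : (p : Point n) → ¬ Is⁻ f (λ K → p ⊆ K)
    not-point⁻ p h = case dec-span (w ∷ a₀ ∷ []) (vec p) of λ where
      (yes u∈ℓ) → clash line-true
        (Equivalence.from (h (K line-probe)) (∋→⊆ p (K line-probe) (line-through u∈ℓ)))
      (no u∉ℓ) → case some-off-probe (vec p ∷ []) (s≤s z≤n) (indep-wua u∉ℓ) of λ where
        (x , x∉π , P) → avoids P (suc zero) (⊆→∋ p (K P) (Equivalence.to (h (K P)) (f-off-probe P x∉π)))

    -- f = π'⁺: the line probe lies in π', and then so does an off-π probe inside π'.
    not-hyperplane⁺ : (π' : Hyperplane n) → ¬ Is⁺ f (λ K → K ⊆ π')
    not-hyperplane⁺ π' h =
      off-inside-π' (fresh π' π w∈π' w∉π (w ∷ a₀ ∷ []) (span-gen (w ∷ a₀ ∷ []) zero) two<n-1)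
      where
      L⊆π' : K line-probe ⊆ π'
      L⊆π' = Equivalence.to (h (K line-probe)) line-true
      w∈π' = L⊆π' w (contains line-probe zero)
      a₀∈π' = L⊆π' a₀ (contains line-probe (suc zero))
      off-inside-π' : (Σ (Vec n) λ x → π' ∋ x × ¬ π ∋ x × ¬ InSpan (w ∷ a₀ ∷ []) x) → ⊥
      off-inside-π' (x , x∈π' , x∉π , x∉ℓ) = clash (Equivalence.from (h (K P)) (K⊆W P)) (f-off-probe P x∉π)
        where
        P = off-probe π' [] w∈π' (λ ()) x∈π' a₀∈π' (indep-cons {x = x} {b = w ∷ a₀ ∷ []} indep-wa x∉ℓ)
              (fits-hyperplane (s≤s z≤n))

    -- f = π'⁻: off-π probes lie in π', hence π ⊆ π', and then f = 0 on spaces inside π.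
    not-hyperplane⁻ : (π' : Hyperplane n) → ¬ Is⁻ f (λ K → K ⊆ π')
    not-hyperplane⁻ π' h = clash inside-true (Equivalence.from (h (K inside-probe)) λ v v∈K →
        π⊆π' v (K⊆W inside-probe v v∈K))
      where
      off⊆π' : OffInside [] π'
      off⊆π' P x∉π = Equivalence.to (h (K P)) (f-off-probe P x∉π)
      π⊆π' : π ⊆ π'
      π⊆π' = transfer-all {Z = []} {Q = π'} off⊆π' z≤n indep-wa 4≤n

    indep-wπ : LinIndep (w ∷ basis π)
    indep-wπ = indep-cons {x = w} {b = basis π} (basis-indep π) (λ w∈π → w∉π (span→mem π w∈π))

    Split : Vec n → Set
    Split v = Σ Carrier λ γ → Σ (Vec n) λ m → π ∋ m × v ≈ᵥ ((γ ·ᵥ w) +ᵥ m)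

    split : ∀ v → Split v
    split v = case indep-spans e (w ∷ basis π) (ℕP.m≤n+m∸n n 1) indep-wπ
                                 (λ _ → everything _) (everything v) of λ where
      (c , v≈) → c zero , linComb (tail c) (basis π) , linComb-mem (proj₁ π) (tail c) (basis π) (basis-mem π) , v≈

    -- f = (p⁺ ∨ π'⁺)⁻: if p ∈ ℓ the line probe refutes it.  Otherwise the off-π probes
    -- avoiding p lie in π', and it suffices to find a k-space through a inside π ∩ π'.
    -- For n > 4, π ⊆ π'; for n = 4 (so k = 2) write p = ⟨γw + m⟩ with m ∈ π: then the
    -- plane ⟨m, a⟩ ⊆ π lies in π'.
    module PointOrHyperplane⁻ (p : Point n) (π' : Hyperplane n) (h : Is⁻ f (λ K → p ⊆ K ⊎ K ⊆ π')) where
      u : Vec n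
      u = vec p

      refute-inside : (K : KSpace n k) → K ∋ a₀ → K ⊆ π → K ⊆ π' → ⊥
      refute-inside K a₀∈K K⊆π K⊆π' = clash (f-inside K a₀∈K K⊆π) (Equivalence.from (h K) (inj₂ K⊆π'))

      off⊆π' : OffInside (u ∷ []) π'
      off⊆π' P x∉π = case Equivalence.to (h (K P)) (f-off-probe P x∉π) of λ where
        (inj₁ p⊆K) → ⊥-elim (avoids P (suc zero) (⊆→∋ p (K P) p⊆K))
        (inj₂ K⊆π') → K⊆π'

      large-case : ¬ InSpan (w ∷ a₀ ∷ []) u → 4 ℕ.< n → ⊥
      large-case u∉ℓ 4<n = refute-inside (K inside-probe) (contains inside-probe zero) (K⊆W inside-probe)
        λ v v∈K → transfer-all {Z = u ∷ []} {Q = π'} off⊆π' (s≤s z≤n) (indep-wua u∉ℓ) 4<n v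
                    (K⊆W inside-probe v v∈K)

      plane-case : ¬ InSpan (w ∷ a₀ ∷ []) u → k ℕ.≤ 2 → Split u → ⊥
      plane-case u∉ℓ k≤2 (γ , m , m∈π , u≈) = refute-inside (K P) (contains P (suc zero)) (K⊆W P) K⊆π'
        where
        F = AvoidBase (u ∷ [])
        ℓ-span = span (w ∷ a₀ ∷ [])
        m∈F : InSpan F m
        m∈F = Mem-cancelˡ (span F) (Mem-≈ (span F) u≈ (span-gen F (suc zero))) (Mem-· (span F) γ (span-gen F zero))
        m∉⟨a⟩ : ¬ InSpan (a₀ ∷ []) m
        m∉⟨a⟩ m∈⟨a⟩ = u∉ℓ (Mem-≈ ℓ-span (≈ᵥ-sym u≈)
          (Mem-+ ℓ-span (Mem-· ℓ-span γ (span-gen (w ∷ a₀ ∷ []) zero)) (span-cons {b = a₀ ∷ []} w m∈⟨a⟩)))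
        P = inside-through m∈π m∉⟨a⟩
        ⟨m,a⟩⊆π' : ∀ {v} → InSpan (m ∷ a₀ ∷ []) v → π' ∋ v
        ⟨m,a⟩⊆π' = span-least (proj₁ π') {b = m ∷ a₀ ∷ []} λ where
          zero → transfer-span {Z = u ∷ []} {Q = π'} off⊆π' (s≤s z≤n) (indep-wua u∉ℓ) m∈π m∈F
          (suc zero) → transfer-span {Z = u ∷ []} {Q = π'} off⊆π' (s≤s z≤n) (indep-wua u∉ℓ) a₀∈π
                         (span-gen F (suc (suc zero)))
        K⊆π' : K P ⊆ π'
        K⊆π' v v∈K = ⟨m,a⟩⊆π' (indep-spans (basis (K P)) (m ∷ a₀ ∷ []) k≤2
          (indep-cons {x = m} {b = a₀ ∷ []} indep-a m∉⟨a⟩)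
          (λ { zero → mem→span (K P) (contains P zero) ; (suc zero) → mem→span (K P) (contains P (suc zero)) })
          (mem→span (K P) v∈K))

      refuted : ⊥
      refuted = case dec-span (w ∷ a₀ ∷ []) u of λ where
        (yes u∈ℓ) → clash line-true
          (Equivalence.from (h (K line-probe)) (inj₁ (∋→⊆ p (K line-probe) (line-through u∈ℓ))))
        (no u∉ℓ) → case 4 ℕ.<? n of λ where
          (yes 4<n) → large-case u∉ℓ 4<n
          (no 4≮n) → plane-case u∉ℓ (ℕP.*-cancelˡ-≤ 2 (ℕP.≤-trans n≥2k (ℕP.≮⇒≥ 4≮n))) (split u)

    -- The remaining shape f = p⁺ ∨ π'⁺ with p ∉ π' is the conclusion: a ∈ π' (else f would
    -- be the indicator of p through a), p ∉ π, π = π', and finally p ∈ ℓ.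
    module PointOrHyperplane⁺ (p : Point n) (π' : Hyperplane n) (p⊈π' : ¬ (p ⊆ π'))
                              (h : Is⁺ f (λ K → p ⊆ K ⊎ K ⊆ π')) where
      u : Vec n
      u = vec p

      u∉π' : ¬ π' ∋ u
      u∉π' u∈π' = p⊈π' (∋→⊆ p π' u∈π')

      true⇒⊆π' : (K : KSpace n k) → f K ≡ true → ¬ K ∋ u → K ⊆ π'
      true⇒⊆π' K fK u∉K = case Equivalence.to (h K) fK of λ where
        (inj₁ p⊆K) → ⊥-elim (u∉K (⊆→∋ p K p⊆K))
        (inj₂ K⊆π') → K⊆π'

      a₀∈π' : π' ∋ a₀
      a₀∈π' = case dec-mem π' a₀ of λ where
        (yes a₀∈π') → a₀∈π'
        (no a₀∉π') → ⊥-elim (not-indicator u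
          (λ K a₀∈K fK → case Equivalence.to (h K) fK of λ where
             (inj₁ p⊆K) → ⊆→∋ p K p⊆K
             (inj₂ K⊆π') → ⊥-elim (a₀∉π' (K⊆π' a₀ a₀∈K)))
          (λ K _ u∈K → Equivalence.from (h K) (inj₁ (∋→⊆ p K u∈K))))

      -- If u ∈ π, take d ∈ π \ π' outside ⟨u, a⟩: a k-space inside π through d and a that
      -- avoids u has f = 1, so it lies in π', which d does not.
      u∉π : ¬ π ∋ u
      u∉π u∈π =
        case fresh π π' u∈π u∉π' (u ∷ a₀ ∷ []) (span-gen (u ∷ a₀ ∷ []) zero) two<n-1 of λ where
          (d , d∈π , d∉π' , d∉⟨u,a⟩) → d∉π' (into-π' d∈π d∉⟨u,a⟩)
        where
        u∉⟨a⟩ : ¬ InSpan (a₀ ∷ []) u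
        u∉⟨a⟩ u∈⟨a⟩ = u∉π' (⟨a⟩-⊆ π' a₀∈π' u∈⟨a⟩)
        into-π' : ∀ {d} → π ∋ d → ¬ InSpan (u ∷ a₀ ∷ []) d → π' ∋ d
        into-π' {d} d∈π d∉⟨u,a⟩ =
          true⇒⊆π' (K P) (f-inside (K P) (contains P (suc zero)) (K⊆W P)) (avoids P zero) d (contains P zero)
          where
          indep-uda : LinIndep (u ∷ d ∷ a₀ ∷ [])
          indep-uda = indep-≼ {A' = u ∷ d ∷ a₀ ∷ []} {A = d ∷ u ∷ a₀ ∷ []} (≼-swap {X = a₀ ∷ []} u d)
            (indep-cons {x = d} {b = u ∷ a₀ ∷ []} (indep-cons {x = u} {b = a₀ ∷ []} indep-a u∉⟨a⟩) d∉⟨u,a⟩)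
          P = probe k π (u ∷ []) (d ∷ a₀ ∷ []) (λ { zero → u∈π }) (λ { zero → d∈π ; (suc zero) → a₀∈π }) indep-uda
                (at-most-k ℕP.≤-refl) (fits-hyperplane (s≤s z≤n))

      -- Every v ∈ π \ ⟨a⟩ lies in a k-space inside π through a, which has f = 1 and misses p.
      π⊆π' : π ⊆ π'
      π⊆π' v v∈π = case dec-span (a₀ ∷ []) v of λ where
        (yes v∈⟨a⟩) → ⟨a⟩-⊆ π' a₀∈π' v∈⟨a⟩
        (no v∉⟨a⟩) → let P = inside-through v∈π v∉⟨a⟩ in
          true⇒⊆π' (K P) (f-inside (K P) (contains P (suc zero)) (K⊆W P)) (λ u∈K → u∉π (K⊆W P u u∈K))
                   v (contains P zero)

      π'⊆π : π' ⊆ π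
      π'⊆π = same-dim-⊆ π π' π⊆π'

      -- If u ∉ ⟨w, a⟩, a k-space through ℓ avoiding u has f = 1, so it lies in π' = π; but w ∉ π.
      u∈ℓ : InSpan (w ∷ a₀ ∷ []) u
      u∈ℓ = case dec-span (w ∷ a₀ ∷ []) u of λ where
        (yes u∈ℓ) → u∈ℓ
        (no u∉ℓ) → let P = probe k whole (u ∷ []) (w ∷ a₀ ∷ []) (λ _ → everything _) (λ _ → everything _)
                               (indep-cons {x = u} {b = w ∷ a₀ ∷ []} indep-wa u∉ℓ) (at-most-k ℕP.≤-refl)
                               (fits-whole (s≤s z≤n)) in
          ⊥-elim (w∉π (π'⊆π w (true⇒⊆π' (K P) (f-line (K P) (contains P (suc zero)) (contains P zero))
                                 (avoids P zero) w (contains P zero))))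

      conclusion : Σ (Point n) λ p' → p' ⊆ ℓ × ¬ (p' ≐ a) × Is⁺ f (λ K → p' ⊆ K ⊎ K ⊆ π)
      conclusion = p , p⊆ℓ , p≠a , λ K → mk⇔
          (λ fK → Sum.map₂ (λ K⊆π' v v∈K → π'⊆π v (K⊆π' v v∈K)) (Equivalence.to (h K) fK))
          (λ c → Equivalence.from (h K) (Sum.map₂ (λ K⊆π v v∈K → π⊆π' v (K⊆π v v∈K)) c))
        where
        p⊆ℓ : p ⊆ ℓ
        p⊆ℓ = ∋→⊆ p ℓ (⟨w,a⟩-⊆ ℓ w∈ℓ a₀∈ℓ u∈ℓ)
        p≠a : ¬ (p ≐ a)
        p≠a (p⊆a , _) = u∉π (a⊆π u (p⊆a u (basis-mem p zero)))

-- Multiplication of natural numbers for the statement (not in scope above, where the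
-- field's multiplication is used).
open import Data.Nat using (_*_)

lemma4p7 : (q : ℕ) → IsPrimePower q → (𝔽 : FiniteField q) → (n k : ℕ) → k ≥ 2 → n ≥ 2 * k →
    let open Geometry 𝔽 in
    (f : KSpace n k → Bool) → Trivial f →
    (π : Hyperplane n) (a : Point n) (ℓ : Line n) →
    a ⊆ π → ¬ (ℓ ⊆ π) → a ⊆ ℓ →
    (∀ (K : KSpace n k) → a ⊆ K →
        (K ⊆ π → f K ≡ true)
      × (ℓ ⊆ K → f K ≡ true)
      × (¬ (K ⊆ π) → ¬ (ℓ ⊆ K) → f K ≡ false)) →
    Σ (Point n) λ p → p ⊆ ℓ × ¬ (p ≐ a) × Is⁺ f (λ K → p ⊆ K ⊎ K ⊆ π)
lemma4p7 q _ 𝔽 n k k≥2 n≥2k f trivial π a ℓ a⊆π ℓ⊈π a⊆ℓ H = classify trivial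
  where
  open Geometry 𝔽
  open Proof.Situation 𝔽 n k k≥2 n≥2k f π a ℓ a⊆π ℓ⊈π a⊆ℓ H
  classify : Trivial f → Σ (Point n) λ p → p ⊆ ℓ × ¬ (p ≐ a) × Is⁺ f (λ K → p ⊆ K ⊎ K ⊆ π)
  classify (inj₁ f≡1) = ⊥-elim (not-one f≡1)
  classify (inj₂ (inj₁ f≡0)) = ⊥-elim (not-zero f≡0)
  classify (inj₂ (inj₂ (inj₁ (p , h)))) = ⊥-elim (not-point⁺ p h)
  classify (inj₂ (inj₂ (inj₂ (inj₁ (p , h))))) = ⊥-elim (not-point⁻ p h)
  classify (inj₂ (inj₂ (inj₂ (inj₂ (inj₁ (π' , h)))))) = ⊥-elim (not-hyperplane⁺ π' h)
  classify (inj₂ (inj₂ (inj₂ (inj₂ (inj₂ (inj₁ (π' , h))))))) = ⊥-elim (not-hyperplane⁻ π' h)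
  classify (inj₂ (inj₂ (inj₂ (inj₂ (inj₂ (inj₂ (inj₁ (p , π' , p⊈π' , h)))))))) =
    PointOrHyperplane⁺.conclusion p π' p⊈π' h
  classify (inj₂ (inj₂ (inj₂ (inj₂ (inj₂ (inj₂ (inj₂ (p , π' , _ , h)))))))) =
    ⊥-elim (PointOrHyperplane⁻.refuted p π' h)
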